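{- Let $x=(x_1,x_2,x_3)\in\mathbb{Z}^3$ satisfy $x_3^2-2x_2^2+x_1^2=2$. All congruences below are modulo $8$. Then $x$ is in the $H$-orbit of: (1) $(1,0,1)$ if and only if both $x_1$ and $x_3$ are congruent to $1$ or $3$; (2) $(-1,0,-1)$ if and only if both $x_1$ and $x_3$ are congruent to $-1$ or $-3$; (3) $(-1,0,1)$ if and only if either $x_1$ is congruent to $-1$ or $-3$ and $x_3$ is congruent to $1$ or $3$, or $x_3$ is congruent to $-1$ or $-3$ and $x_1$ is congruent to $1$ or $3$; (4) $(2,1,0)$ if and only if either $x_1$ or $x_3$ is congruent to $2$; (5) $(-2,1,0)$ if and only if either $x_1$ or $x_3$ is congruent to $-2$.
   Context: Let $B=\begin{pmatrix}3&4&0\\2&3&0\\0&0&1\end{pmatrix}$, $J=\begin{pmatrix}0&0&1\\0&1&0\\1&0&0\end{pmatrix}$, and let $H$ be the subgroup of $\mathrm{GL}_3(\mathbb{Z})$ generated by $B$ and $J$, acting on column vectors of $\mathbb{Z}^3$ by left multiplication. The $H$-orbit of $v$ is $\{Mv: M\in H\}$. -}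

module Defs where

open import Data.Integer using (ℤ; +_; -[1+_]; _+_; _*_; _-_; -_)
open import Data.Integer.Divisibility using (_∣_)
open import Data.Product using (_×_; _,_; ∃-syntax)
open import Relation.Binary.PropositionalEquality using (_≡_)

Vec3 : Set
Vec3 = ℤ × ℤ × ℤ

record Mat3 : Set where
  constructor mat
  field
    a11 a12 a13 a21 a22 a23 a31 a32 a33 : ℤ
open Mat3 public

_·_ : Mat3 → Vec3 → Vec3
M · (x , y , z) =
  ( a11 M * x + a12 M * y + a13 M * z
  , a21 M * x + a22 M * y + a23 M * z
  , a31 M * x + a32 M * y + a33 M * z )

_⊗_ : Mat3 → Mat3 → Mat3
M ⊗ N = mat
  (a11 M * a11 N + a12 M * a21 N + a13 M * a31 N)
  (a11 M * a12 N + a12 M * a22 N + a13 M * a32 N)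
  (a11 M * a13 N + a12 M * a23 N + a13 M * a33 N)
  (a21 M * a11 N + a22 M * a21 N + a23 M * a31 N)
  (a21 M * a12 N + a22 M * a22 N + a23 M * a32 N)
  (a21 M * a13 N + a22 M * a23 N + a23 M * a33 N)
  (a31 M * a11 N + a32 M * a21 N + a33 M * a31 N)
  (a31 M * a12 N + a32 M * a22 N + a33 M * a32 N)
  (a31 M * a13 N + a32 M * a23 N + a33 M * a33 N)

I3 : Mat3
I3 = mat (+ 1) (+ 0) (+ 0) (+ 0) (+ 1) (+ 0) (+ 0) (+ 0) (+ 1)

B : Mat3
B = mat (+ 3) (+ 4) (+ 0) (+ 2) (+ 3) (+ 0) (+ 0) (+ 0) (+ 1)

-- inverse of B in GL₃(ℤ) (det B = 1)
B⁻¹ : Mat3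
B⁻¹ = mat (+ 3) (- (+ 4)) (+ 0) (- (+ 2)) (+ 3) (+ 0) (+ 0) (+ 0) (+ 1)

J : Mat3
J = mat (+ 0) (+ 0) (+ 1) (+ 0) (+ 1) (+ 0) (+ 1) (+ 0) (+ 0)

-- H = subgroup of GL₃(ℤ) generated by B and J: all finite products
-- of B, B⁻¹, J (= J⁻¹), including the empty product I.
data InH : Mat3 → Set where
  h-id  : InH I3
  h-B   : ∀ {M} → InH M → InH (B ⊗ M)
  h-B⁻¹ : ∀ {M} → InH M → InH (B⁻¹ ⊗ M)
  h-J   : ∀ {M} → InH M → InH (J ⊗ M)

InOrbit : Vec3 → Vec3 → Set
InOrbit v x = ∃[ M ] (InH M × x ≡ M · v)

infix 4 _≡₈_
_≡₈_ : ℤ → ℤ → Set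
a ≡₈ b = (+ 8) ∣ (a - b)

-- H preserves the form Q(x) = x₃² − 2x₂² + x₁², and the proof has two halves.
--  * Descent: every solution lies in the orbit of one of the five representatives.
--    By strong induction on |x₂|: if |x₂| ≥ 2 then, after swapping x₁ and x₃ by J,
--    |x₂| < |x₁| < 2|x₂|, and B or B⁻¹ replaces x₂ by ±(3|x₂| − 2|x₁|), which is
--    smaller in absolute value; solutions with |x₂| ≤ 1 are listed explicitly.
--  * Invariants: the generators preserve the lattice 8ℤ ⊕ 2ℤ ⊕ 8ℤ, so they act on
--    residue classes modulo it.  The classes met by each orbit form a small table
--    closed under the generators, and each table satisfies exactly one of the five
--    congruence conditions; these finite facts are checked by evaluation.
-- Forward implications follow from invariance, backward ones from descent together
-- with exclusivity.
module Submission where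

open import Defs
open import Data.Integer using (ℤ; +_; _+_; _*_; _-_; -_)
open import Data.Product using (_×_; _,_)
open import Data.Sum using (_⊎_)
open import Function.Bundles using (_⇔_)
open import Relation.Binary.PropositionalEquality using (_≡_)

open import Data.Integer using (-[1+_]; ∣_∣; _⊖_)
import Data.Integer.Properties as ℤ
open import Data.Integer.Divisibility using (_∣_)
import Data.Integer.Divisibility.Signed as Signed
open import Data.Integer.Tactic.RingSolver using (solve-∀)
open import Data.Fin using (Fin; zero; suc)
open import Data.Nat as ℕ using (ℕ; zero; suc; _<_; _≤_)
import Data.Nat.Properties as ℕ
import Data.Nat.Tactic.RingSolver as ℕ-Solver
open import Data.Nat.Induction using (<-rec)
open import Data.Product using (Σ; proj₁; proj₂)
open import Data.Sum using (inj₁; inj₂)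
open import Data.Empty using (⊥; ⊥-elim)
open import Relation.Nullary using (¬_; Dec; yes; no)
open import Relation.Nullary.Decidable using (from-yes; _×-dec_; _⊎-dec_; _→-dec_)
import Data.Nat.Divisibility as ℕ∣
import Data.Fin.Properties as Fin
open import Data.List using (List; []; _∷_)
open import Data.List.Relation.Unary.Any as Any using (Any)
open import Data.List.Relation.Unary.All as All using (All)
open import Function using (_∘_)
open import Function.Bundles using (mk⇔)
import Data.Product as Product
import Data.Sum as Sum
open import Relation.Binary.PropositionalEquality
  using (refl; sym; trans; cong; cong₂; subst; module ≡-Reasoning)

pick₁ : ∀ x y z → + 1 * x + + 0 * y + + 0 * z ≡ x
pick₁ = solve-∀

pick₂ : ∀ x y z → + 0 * x + + 1 * y + + 0 * z ≡ y
pick₂ = solve-∀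

pick₃ : ∀ x y z → + 0 * x + + 0 * y + + 1 * z ≡ z
pick₃ = solve-∀

I3-· : ∀ v → I3 · v ≡ v
I3-· (x , y , z) = cong₂ _,_ (pick₁ x y z) (cong₂ _,_ (pick₂ x y z) (pick₃ x y z))

row-assoc : ∀ m₁₁ m₁₂ m₁₃ m₂₁ m₂₂ m₂₃ m₃₁ m₃₂ m₃₃ x y z a b c →
  (a * m₁₁ + b * m₂₁ + c * m₃₁) * x + (a * m₁₂ + b * m₂₂ + c * m₃₂) * y
    + (a * m₁₃ + b * m₂₃ + c * m₃₃) * z
  ≡ a * (m₁₁ * x + m₁₂ * y + m₁₃ * z) + b * (m₂₁ * x + m₂₂ * y + m₂₃ * z)
    + c * (m₃₁ * x + m₃₂ * y + m₃₃ * z)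
row-assoc = solve-∀

·-⊗ : ∀ G M v → (G ⊗ M) · v ≡ G · (M · v)
·-⊗ (mat g₁₁ g₁₂ g₁₃ g₂₁ g₂₂ g₂₃ g₃₁ g₃₂ g₃₃) (mat m₁₁ m₁₂ m₁₃ m₂₁ m₂₂ m₂₃ m₃₁ m₃₂ m₃₃) (x , y , z) =
  cong₂ _,_ (row-assoc m₁₁ m₁₂ m₁₃ m₂₁ m₂₂ m₂₃ m₃₁ m₃₂ m₃₃ x y z g₁₁ g₁₂ g₁₃)
    (cong₂ _,_ (row-assoc m₁₁ m₁₂ m₁₃ m₂₁ m₂₂ m₂₃ m₃₁ m₃₂ m₃₃ x y z g₂₁ g₂₂ g₂₃)
               (row-assoc m₁₁ m₁₂ m₁₃ m₂₁ m₂₂ m₂₃ m₃₁ m₃₂ m₃₃ x y z g₃₁ g₃₂ g₃₃))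

cancel : ∀ G′ G → G′ ⊗ G ≡ I3 → ∀ v → G′ · (G · v) ≡ v
cancel G′ G inverse v = begin
  G′ · (G · v)  ≡⟨ sym (·-⊗ G′ G v) ⟩
  (G′ ⊗ G) · v  ≡⟨ cong (_· v) inverse ⟩
  I3 · v        ≡⟨ I3-· v ⟩
  v             ∎
  where open ≡-Reasoning

J-swap : ∀ x₁ x₂ x₃ → J · (x₃ , x₂ , x₁) ≡ (x₁ , x₂ , x₃)
J-swap x₁ x₂ x₃ = cong₂ _,_ (pick₃ x₃ x₂ x₁) (cong₂ _,_ (pick₂ x₃ x₂ x₁) (pick₁ x₃ x₂ x₁))

record Stable (P : Vec3 → Set) : Set where
  field
    under-B   : ∀ {v} → P v → P (B · v)
    under-B⁻¹ : ∀ {v} → P v → P (B⁻¹ · v)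
    under-J   : ∀ {v} → P v → P (J · v)
open Stable

module _ {P : Vec3 → Set} (stable : Stable P) where

  preserved-by-H : ∀ {M} → InH M → ∀ {v} → P v → P (M · v)
  preserved-by-H h-id        {v} p = subst P (sym (I3-· v)) p
  preserved-by-H (h-B {M} h) {v} p =
    subst P (sym (·-⊗ B M v)) (under-B stable (preserved-by-H h p))
  preserved-by-H (h-B⁻¹ {M} h) {v} p =
    subst P (sym (·-⊗ B⁻¹ M v)) (under-B⁻¹ stable (preserved-by-H h p))
  preserved-by-H (h-J {M} h) {v} p =
    subst P (sym (·-⊗ J M v)) (under-J stable (preserved-by-H h p))

  constant-on-orbits : ∀ {v x} → InOrbit v x → P v → P x
  constant-on-orbits (M , h , refl) p = preserved-by-H h p

  -- Since B⁻¹ ⊗ B = B ⊗ B⁻¹ = I3 (by computation) and J² swaps back, a stable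
  -- predicate can also be pulled back along each generator.
  pull-B : ∀ {v} → P (B · v) → P v
  pull-B {v} p = subst P (cancel B⁻¹ B refl v) (under-B⁻¹ stable p)

  pull-B⁻¹ : ∀ {v} → P (B⁻¹ · v) → P v
  pull-B⁻¹ {v} p = subst P (cancel B B⁻¹ refl v) (under-B stable p)

  pull-swap : ∀ {x₁ x₂ x₃} → P (x₃ , x₂ , x₁) → P (x₁ , x₂ , x₃)
  pull-swap {x₁} {x₂} {x₃} p = subst P (J-swap x₁ x₂ x₃) (under-J stable p)

orbit-stable : ∀ v → Stable (InOrbit v)
orbit-stable v = record
  { under-B   = λ { (M , h , refl) → B ⊗ M , h-B h , sym (·-⊗ B M v) }
  ; under-B⁻¹ = λ { (M , h , refl) → B⁻¹ ⊗ M , h-B⁻¹ h , sym (·-⊗ B⁻¹ M v) }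
  ; under-J   = λ { (M , h , refl) → J ⊗ M , h-J h , sym (·-⊗ J M v) }
  }

Q : Vec3 → ℤ
Q (x₁ , x₂ , x₃) = x₃ * x₃ - + 2 * (x₂ * x₂) + x₁ * x₁

Q-B : ∀ x₁ x₂ x₃ → Q (B · (x₁ , x₂ , x₃)) ≡ Q (x₁ , x₂ , x₃)
Q-B = invariance
  where
  invariance : ∀ x y z →
    (+ 0 * x + + 0 * y + + 1 * z) * (+ 0 * x + + 0 * y + + 1 * z)
      - + 2 * ((+ 2 * x + + 3 * y + + 0 * z) * (+ 2 * x + + 3 * y + + 0 * z))
      + (+ 3 * x + + 4 * y + + 0 * z) * (+ 3 * x + + 4 * y + + 0 * z)
    ≡ z * z - + 2 * (y * y) + x * x
  invariance = solve-∀

Q-B⁻¹ : ∀ x₁ x₂ x₃ → Q (B⁻¹ · (x₁ , x₂ , x₃)) ≡ Q (x₁ , x₂ , x₃)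
Q-B⁻¹ = invariance
  where
  invariance : ∀ x y z →
    (+ 0 * x + + 0 * y + + 1 * z) * (+ 0 * x + + 0 * y + + 1 * z)
      - + 2 * ((- + 2 * x + + 3 * y + + 0 * z) * (- + 2 * x + + 3 * y + + 0 * z))
      + (+ 3 * x + - + 4 * y + + 0 * z) * (+ 3 * x + - + 4 * y + + 0 * z)
    ≡ z * z - + 2 * (y * y) + x * x
  invariance = solve-∀

Q-swap : ∀ x₁ x₂ x₃ → Q (x₃ , x₂ , x₁) ≡ Q (x₁ , x₂ , x₃)
Q-swap = symmetry
  where
  symmetry : ∀ x y z → x * x - + 2 * (y * y) + z * z ≡ z * z - + 2 * (y * y) + x * x
  symmetry = solve-∀

infixl 8 _²
_² : ℕ → ℕ
n ² = n ℕ.* n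

square-abs : ∀ x → x * x ≡ + (∣ x ∣ ²)
square-abs (+ n)    = sym (ℤ.pos-* n n)
square-abs -[1+ n ] = refl

norm-equation : ∀ x₁ x₂ x₃ → Q (x₁ , x₂ , x₃) ≡ + 2 →
                ∣ x₁ ∣ ² ℕ.+ ∣ x₃ ∣ ² ≡ 2 ℕ.+ 2 ℕ.* ∣ x₂ ∣ ²
norm-equation x₁ x₂ x₃ q = ℤ.+-injective (begin
  + (∣ x₁ ∣ ² ℕ.+ ∣ x₃ ∣ ²)            ≡⟨ ℤ.pos-+ (∣ x₁ ∣ ²) (∣ x₃ ∣ ²) ⟩
  + (∣ x₁ ∣ ²) + + (∣ x₃ ∣ ²)          ≡⟨ sym (cong₂ _+_ (square-abs x₁) (square-abs x₃)) ⟩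
  x₁ * x₁ + x₃ * x₃                    ≡⟨ regroup x₁ x₂ x₃ ⟩
  Q (x₁ , x₂ , x₃) + + 2 * (x₂ * x₂)   ≡⟨ cong₂ (λ u w → u + + 2 * w) q (square-abs x₂) ⟩
  + 2 + + 2 * + (∣ x₂ ∣ ²)             ≡⟨ cong (λ w → + 2 + w) (sym (ℤ.pos-* 2 (∣ x₂ ∣ ²))) ⟩
  + (2 ℕ.+ 2 ℕ.* ∣ x₂ ∣ ²)             ∎)
  where
  open ≡-Reasoning
  regroup : ∀ x y z → x * x + z * z ≡ (z * z - + 2 * (y * y) + x * x) + + 2 * (y * y)
  regroup = solve-∀

squares≤sum : ∀ a c {n} → a ² ℕ.+ c ² ≡ n → a ² ≤ n × c ² ≤ n
squares≤sum a c refl = ℕ.m≤m+n (a ²) (c ²) , ℕ.m≤n+m (c ²) (a ²)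

too-large : ∀ {m a n} → m ≤ a → a ² ≤ n → n < m ² → ⊥
too-large m≤a a²≤n n<m² = ℕ.<⇒≱ n<m² (ℕ.≤-trans (ℕ.*-mono-≤ m≤a m≤a) a²≤n)

two-squares-2 : ∀ a c → a ² ℕ.+ c ² ≡ 2 → a ≡ 1 × c ≡ 1
two-squares-2 (suc (suc a)) c e =
  ⊥-elim (too-large (ℕ.m≤m+n 2 a) (proj₁ (squares≤sum (2 ℕ.+ a) c e)) (ℕ.m≤m+n 3 1))
two-squares-2 a (suc (suc c)) e =
  ⊥-elim (too-large (ℕ.m≤m+n 2 c) (proj₂ (squares≤sum a (2 ℕ.+ c) e)) (ℕ.m≤m+n 3 1))
two-squares-2 1 1 _ = refl , refl
two-squares-2 0 0 ()
two-squares-2 0 1 ()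
two-squares-2 1 0 ()

two-squares-4 : ∀ a c → a ² ℕ.+ c ² ≡ 4 → (a ≡ 2 × c ≡ 0) ⊎ (a ≡ 0 × c ≡ 2)
two-squares-4 (suc (suc (suc a))) c e =
  ⊥-elim (too-large (ℕ.m≤m+n 3 a) (proj₁ (squares≤sum (3 ℕ.+ a) c e)) (ℕ.m≤m+n 5 4))
two-squares-4 a (suc (suc (suc c))) e =
  ⊥-elim (too-large (ℕ.m≤m+n 3 c) (proj₂ (squares≤sum a (3 ℕ.+ c) e)) (ℕ.m≤m+n 5 4))
two-squares-4 2 0 _ = inj₁ (refl , refl)
two-squares-4 0 2 _ = inj₂ (refl , refl)
two-squares-4 0 0 ()
two-squares-4 0 1 ()
two-squares-4 1 0 ()
two-squares-4 1 1 ()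
two-squares-4 1 2 ()
two-squares-4 2 1 ()
two-squares-4 2 2 ()

some-coordinate-exceeds : ∀ a b c → a ² ℕ.+ c ² ≡ 2 ℕ.+ 2 ℕ.* b ² → a ≤ b → c ≤ b → ⊥
some-coordinate-exceeds a b c e a≤b c≤b = 2≰0 (ℕ.+-cancelʳ-≤ (2 ℕ.* b ²) 2 0 bound)
  where
  2≰0 : ¬ 2 ≤ 0
  2≰0 ()
  double : ∀ b → b ℕ.* b ℕ.+ b ℕ.* b ≡ 0 ℕ.+ 2 ℕ.* (b ℕ.* b)
  double = ℕ-Solver.solve-∀
  bound : 2 ℕ.+ 2 ℕ.* b ² ≤ 0 ℕ.+ 2 ℕ.* b ²
  bound = ℕ.≤-trans (ℕ.≤-reflexive (sym e))
            (ℕ.≤-trans (ℕ.+-mono-≤ (ℕ.*-mono-≤ a≤b a≤b) (ℕ.*-mono-≤ c≤b c≤b)) (ℕ.≤-reflexive (double b)))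

below-double : ∀ a b c → a ² ℕ.+ c ² ≡ 2 ℕ.+ 2 ℕ.* b ² → 2 ≤ b → a < 2 ℕ.* b
below-double a b c e 2≤b with a ℕ.<? 2 ℕ.* b
... | yes a<2b = a<2b
... | no a≮2b = ⊥-elim (ℕ.<⇒≱ 2<2b² (ℕ.+-cancelʳ-≤ (2 ℕ.* b ²) (2 ℕ.* b ²) 2 bound))
  where
  quadruple : ∀ b → (2 ℕ.* b) ℕ.* (2 ℕ.* b) ≡ 2 ℕ.* (b ℕ.* b) ℕ.+ 2 ℕ.* (b ℕ.* b)
  quadruple = ℕ-Solver.solve-∀
  2<2b² : 2 < 2 ℕ.* b ²
  2<2b² = ℕ.≤-trans (ℕ.m≤m+n 3 5) (ℕ.*-monoʳ-≤ 2 (ℕ.*-mono-≤ 2≤b 2≤b))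
  bound : 2 ℕ.* b ² ℕ.+ 2 ℕ.* b ² ≤ 2 ℕ.+ 2 ℕ.* b ²
  bound = ℕ.≤-trans (ℕ.≤-reflexive (sym (quadruple b)))
            (ℕ.≤-trans (ℕ.*-mono-≤ (ℕ.≮⇒≥ a≮2b) (ℕ.≮⇒≥ a≮2b))
              (ℕ.≤-trans (ℕ.m≤m+n (a ²) (c ²)) (ℕ.≤-reflexive e)))

shrinks : ∀ {a b} → b < a → a < 2 ℕ.* b → ∣ 3 ℕ.* b ⊖ 2 ℕ.* a ∣ < b
shrinks {a} {zero} _ ()
shrinks {a} {b@(suc _)} b<a a<2b with 3 ℕ.* b ℕ.≤? 2 ℕ.* a
... | yes 3b≤2a = subst (_< b) (sym (ℤ.∣⊖∣-≤ 3b≤2a))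
                    (ℕ.m<n+o⇒m∸n<o (2 ℕ.* a) (3 ℕ.* b) (subst (2 ℕ.* a <_) (four b) (ℕ.*-monoʳ-< 2 a<2b)))
  where
  four : ∀ b → 2 ℕ.* (2 ℕ.* b) ≡ 3 ℕ.* b ℕ.+ b
  four = ℕ-Solver.solve-∀
... | no 3b≰2a = subst (_< b) (sym (trans (ℤ.∣m⊖n∣≡∣n⊖m∣ (3 ℕ.* b) (2 ℕ.* a)) (ℤ.∣⊖∣-≰ 3b≰2a)))
                   (ℕ.m<n+o⇒m∸n<o (3 ℕ.* b) (2 ℕ.* a) (subst (_< 2 ℕ.* a ℕ.+ b) (sym (three b)) (ℕ.+-monoˡ-< b (ℕ.*-monoʳ-< 2 b<a))))
  where
  three : ∀ b → 3 ℕ.* b ≡ 2 ℕ.* b ℕ.+ b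
  three = ℕ-Solver.solve-∀

Kind : Set
Kind = Fin 5

pattern o₁ = zero
pattern o₂ = suc zero
pattern o₃ = suc (suc zero)
pattern o₄ = suc (suc (suc zero))
pattern o₅ = suc (suc (suc (suc zero)))

rep : Kind → Vec3
rep o₁ = (+ 1 , + 0 , + 1)
rep o₂ = (- + 1 , + 0 , - + 1)
rep o₃ = (- + 1 , + 0 , + 1)
rep o₄ = (+ 2 , + 1 , + 0)
rep o₅ = (- + 2 , + 1 , + 0)

InSomeOrbit : Vec3 → Set
InSomeOrbit x = Σ Kind λ k → InOrbit (rep k) x

some-orbit-stable : Stable InSomeOrbit
some-orbit-stable = record
  { under-B   = λ { (k , o) → k , under-B   (orbit-stable (rep k)) o }
  ; under-B⁻¹ = λ { (k , o) → k , under-B⁻¹ (orbit-stable (rep k)) o }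
  ; under-J   = λ { (k , o) → k , under-J   (orbit-stable (rep k)) o }
  }

image : ∀ k {M} → InH M → InSomeOrbit (M · rep k)
image k {M} h = k , M , h , refl

abs≡ : ∀ x {n} → ∣ x ∣ ≡ n → x ≡ + n ⊎ x ≡ - + n
abs≡ (+ _)    refl = inj₁ refl
abs≡ -[1+ _ ] refl = inj₂ refl

middle-zero : ∀ x₁ x₃ → Q (x₁ , + 0 , x₃) ≡ + 2 → InSomeOrbit (x₁ , + 0 , x₃)
middle-zero x₁ x₃ q with two-squares-2 ∣ x₁ ∣ ∣ x₃ ∣ (norm-equation x₁ (+ 0) x₃ q)
... | a≡1 , c≡1 with abs≡ x₁ a≡1 | abs≡ x₃ c≡1
... | inj₁ refl | inj₁ refl = image o₁ h-id
... | inj₂ refl | inj₂ refl = image o₂ h-id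
... | inj₂ refl | inj₁ refl = image o₃ h-id
... | inj₁ refl | inj₂ refl = image o₃ (h-J h-id)

-- Base of the descent, |x₂| = 1: then x = (±2, ±1, 0) or (0, ±1, ±2).
-- The vectors (±2, −1, 0) are B∓¹ · (±2, 1, 0); the others are reached by J.
middle-one-edge : ∀ x₁ x₂ → ∣ x₁ ∣ ≡ 2 → ∣ x₂ ∣ ≡ 1 → InSomeOrbit (x₁ , x₂ , + 0)
middle-one-edge x₁ x₂ a≡2 b≡1 with abs≡ x₁ a≡2 | abs≡ x₂ b≡1
... | inj₁ refl | inj₁ refl = image o₄ h-id
... | inj₂ refl | inj₁ refl = image o₅ h-id
... | inj₁ refl | inj₂ refl = image o₄ (h-B⁻¹ h-id)
... | inj₂ refl | inj₂ refl = image o₅ (h-B h-id)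

middle-one : ∀ x₁ x₂ x₃ → ∣ x₂ ∣ ≡ 1 → Q (x₁ , x₂ , x₃) ≡ + 2 → InSomeOrbit (x₁ , x₂ , x₃)
middle-one x₁ x₂ x₃ b≡1 q
  with two-squares-4 ∣ x₁ ∣ ∣ x₃ ∣ (trans (norm-equation x₁ x₂ x₃ q) (cong (λ b → 2 ℕ.+ 2 ℕ.* b ²) b≡1))
... | inj₁ (a≡2 , c≡0) rewrite ℤ.∣i∣≡0⇒i≡0 {x₃} c≡0 = middle-one-edge x₁ x₂ a≡2 b≡1
... | inj₂ (a≡0 , c≡2) rewrite ℤ.∣i∣≡0⇒i≡0 {x₁} a≡0 = pull-swap some-orbit-stable (middle-one-edge x₃ x₂ c≡2 b≡1)

middle : Vec3 → ℤ
middle (_ , x₂ , _) = x₂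

three-minus-two : ∀ a b → + 3 * + b - + 2 * + a ≡ 3 ℕ.* b ⊖ 2 ℕ.* a
three-minus-two a b =
  trans (cong₂ _-_ (sym (ℤ.pos-* 3 b)) (sym (ℤ.pos-* 2 a))) (ℤ.m-n≡m⊖n (3 ℕ.* b) (2 ℕ.* a))

-- The middle coordinate of B^{±1} · x is ±2x₁ + 3x₂.  Choosing the sign
-- against the signs of x₁ and x₂ makes its absolute value |3|x₂| − 2|x₁||.
middle-after-step : ∀ x₁ x₂ x₃ →
    ∣ middle (B · (x₁ , x₂ , x₃)) ∣   ≡ ∣ 3 ℕ.* ∣ x₂ ∣ ⊖ 2 ℕ.* ∣ x₁ ∣ ∣
  ⊎ ∣ middle (B⁻¹ · (x₁ , x₂ , x₃)) ∣ ≡ ∣ 3 ℕ.* ∣ x₂ ∣ ⊖ 2 ℕ.* ∣ x₁ ∣ ∣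
middle-after-step (+ a) (+ b) x₃ =
  inj₂ (cong ∣_∣ (trans (same-sign (+ a) (+ b) x₃) (three-minus-two a b)))
  where
  same-sign : ∀ p q z → - + 2 * p + + 3 * q + + 0 * z ≡ + 3 * q - + 2 * p
  same-sign = solve-∀
middle-after-step -[1+ a ] (+ b) x₃ =
  inj₁ (cong ∣_∣ (trans (opposite-sign (+ suc a) (+ b) x₃) (three-minus-two (suc a) b)))
  where
  opposite-sign : ∀ p q z → + 2 * (- p) + + 3 * q + + 0 * z ≡ + 3 * q - + 2 * p
  opposite-sign = solve-∀
middle-after-step (+ a) -[1+ b ] x₃ =
  inj₁ (trans (cong ∣_∣ (opposite-sign (+ a) (+ suc b) x₃))
              (trans (ℤ.∣-i∣≡∣i∣ (+ 3 * + suc b - + 2 * + a)) (cong ∣_∣ (three-minus-two a (suc b)))))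
  where
  opposite-sign : ∀ p q z → + 2 * p + + 3 * (- q) + + 0 * z ≡ - (+ 3 * q - + 2 * p)
  opposite-sign = solve-∀
middle-after-step -[1+ a ] -[1+ b ] x₃ =
  inj₂ (trans (cong ∣_∣ (same-sign (+ suc a) (+ suc b) x₃))
              (trans (ℤ.∣-i∣≡∣i∣ (+ 3 * + suc b - + 2 * + suc a)) (cong ∣_∣ (three-minus-two (suc a) (suc b)))))
  where
  same-sign : ∀ p q z → - + 2 * (- p) + + 3 * (- q) + + 0 * z ≡ - (+ 3 * q - + 2 * p)
  same-sign = solve-∀

middle-decreases : ∀ x₁ x₂ x₃ → ∣ x₂ ∣ < ∣ x₁ ∣ → ∣ x₁ ∣ < 2 ℕ.* ∣ x₂ ∣ →
    ∣ middle (B · (x₁ , x₂ , x₃)) ∣ < ∣ x₂ ∣ ⊎ ∣ middle (B⁻¹ · (x₁ , x₂ , x₃)) ∣ < ∣ x₂ ∣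
middle-decreases x₁ x₂ x₃ b<a a<2b =
  Sum.map (below (middle (B · (x₁ , x₂ , x₃)))) (below (middle (B⁻¹ · (x₁ , x₂ , x₃))))
          (middle-after-step x₁ x₂ x₃)
  where
  below : ∀ w → ∣ w ∣ ≡ ∣ 3 ℕ.* ∣ x₂ ∣ ⊖ 2 ℕ.* ∣ x₁ ∣ ∣ → ∣ w ∣ < ∣ x₂ ∣
  below w eq = subst (_< ∣ x₂ ∣) (sym eq) (shrinks b<a a<2b)

Descends : ℕ → Set
Descends n = ∀ x → ∣ middle x ∣ ≡ n → Q x ≡ + 2 → InSomeOrbit x

descent-step : ∀ {n} → (∀ {m} → m < n → Descends m) → ∀ x₁ x₂ x₃ → ∣ x₂ ∣ ≡ n →
               ∣ x₂ ∣ < ∣ x₁ ∣ → ∣ x₁ ∣ < 2 ℕ.* ∣ x₂ ∣ → Q (x₁ , x₂ , x₃) ≡ + 2 →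
               InSomeOrbit (x₁ , x₂ , x₃)
descent-step smaller x₁ x₂ x₃ refl b<a a<2b q with middle-decreases x₁ x₂ x₃ b<a a<2b
... | inj₁ lt = pull-B some-orbit-stable
                  (smaller lt (B · (x₁ , x₂ , x₃)) refl (trans (Q-B x₁ x₂ x₃) q))
... | inj₂ lt = pull-B⁻¹ some-orbit-stable
                  (smaller lt (B⁻¹ · (x₁ , x₂ , x₃)) refl (trans (Q-B⁻¹ x₁ x₂ x₃) q))

descent-large : ∀ {n} → (∀ {m} → m < n → Descends m) → ∀ x₁ x₂ x₃ → ∣ x₂ ∣ ≡ n →
                2 ≤ ∣ x₂ ∣ → Q (x₁ , x₂ , x₃) ≡ + 2 → InSomeOrbit (x₁ , x₂ , x₃)
descent-large smaller x₁ x₂ x₃ b≡n 2≤b q with ∣ x₂ ∣ ℕ.<? ∣ x₁ ∣ | ∣ x₂ ∣ ℕ.<? ∣ x₃ ∣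
... | yes b<a | _ =
  descent-step smaller x₁ x₂ x₃ b≡n b<a (below-double (∣ x₁ ∣) (∣ x₂ ∣) (∣ x₃ ∣) (norm-equation x₁ x₂ x₃ q) 2≤b) q
... | no _ | yes b<c =
  pull-swap some-orbit-stable
    (descent-step smaller x₃ x₂ x₁ b≡n b<c (below-double (∣ x₃ ∣) (∣ x₂ ∣) (∣ x₁ ∣) (norm-equation x₃ x₂ x₁ q′) 2≤b) q′)
  where
  q′ : Q (x₃ , x₂ , x₁) ≡ + 2
  q′ = trans (Q-swap x₁ x₂ x₃) q
... | no b≮a | no b≮c =
  ⊥-elim (some-coordinate-exceeds (∣ x₁ ∣) (∣ x₂ ∣) (∣ x₃ ∣) (norm-equation x₁ x₂ x₃ q) (ℕ.≮⇒≥ b≮a) (ℕ.≮⇒≥ b≮c))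

descent : ∀ x → Q x ≡ + 2 → InSomeOrbit x
descent x = <-rec Descends reduce ∣ middle x ∣ x refl
  where
  reduce : ∀ n → (∀ {m} → m < n → Descends m) → Descends n
  reduce _ smaller (x₁ , + 0 , x₃)               _   q = middle-zero x₁ x₃ q
  reduce _ smaller (x₁ , x₂@(+ 1) , x₃)          _   q = middle-one x₁ x₂ x₃ refl q
  reduce _ smaller (x₁ , x₂@(-[1+ 0 ]) , x₃)     _   q = middle-one x₁ x₂ x₃ refl q
  reduce _ smaller (x₁ , x₂@(+ suc (suc k)) , x₃) b≡n q =
    descent-large smaller x₁ x₂ x₃ b≡n (ℕ.m≤m+n 2 k) q
  reduce _ smaller (x₁ , x₂@(-[1+ suc k ]) , x₃) b≡n q =
    descent-large smaller x₁ x₂ x₃ b≡n (ℕ.m≤m+n 2 k) q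

infix 4 _≡₂_
_≡₂_ : ℤ → ℤ → Set
a ≡₂ b = (+ 2) ∣ (a - b)

-- Since m ∣ a − b unfolds to a statement about ∣ a − b ∣, Agda cannot infer
-- m, a, b from such a proof; they are passed explicitly where needed.

mod-intro : ∀ {m a b} k → a ≡ b + k * m → m ∣ a - b
mod-intro {m} {a} {b} k refl = Signed.∣⇒∣ᵤ (Signed.divides k (cancel-b b (k * m)))
  where
  cancel-b : ∀ b w → b + w - b ≡ w
  cancel-b = solve-∀

mod-elim : ∀ {m a b} → m ∣ a - b → Σ ℤ λ k → a ≡ b + k * m
mod-elim {m} {a} {b} m∣a-b with Signed.∣ᵤ⇒∣ m∣a-b
... | Signed.divides k a-b≡km = k , trans (split a b) (cong (λ w → b + w) a-b≡km)
  where
  split : ∀ a b → a ≡ b + (a - b)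
  split = solve-∀

mod-sym : ∀ {m a b} → m ∣ a - b → m ∣ b - a
mod-sym {m} {a} {b} m∣a-b with mod-elim {m} {a} {b} m∣a-b
... | k , refl = mod-intro {m} {b} (- k) (back b k m)
  where
  back : ∀ b k m → b ≡ (b + k * m) + (- k) * m
  back = solve-∀

mod-trans : ∀ {m a b c} → m ∣ a - b → m ∣ b - c → m ∣ a - c
mod-trans {m} {a} {b} {c} m∣a-b m∣b-c with mod-elim {m} {b} {c} m∣b-c
... | l , refl with mod-elim {m} {a} m∣a-b
... | k , refl = mod-intro {m} {a} {c} (l + k) (regroup c l k m)
  where
  regroup : ∀ c l k m → (c + l * m) + k * m ≡ c + (l + k) * m
  regroup = solve-∀

infix 4 _∼_
_∼_ : Vec3 → Vec3 → Set
(x₁ , x₂ , x₃) ∼ (t₁ , t₂ , t₃) = x₁ ≡₈ t₁ × x₂ ≡₂ t₂ × x₃ ≡₈ t₃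

∼-sym : ∀ {x t} → x ∼ t → t ∼ x
∼-sym {x₁ , x₂ , x₃} {t₁ , t₂ , t₃} (e₁ , e₂ , e₃) =
  mod-sym {+ 8} {x₁} e₁ , mod-sym {+ 2} {x₂} e₂ , mod-sym {+ 8} {x₃} e₃

∼-trans : ∀ {x t u} → x ∼ t → t ∼ u → x ∼ u
∼-trans {x₁ , x₂ , x₃} {t₁ , t₂ , t₃} {u₁ , u₂ , u₃} (e₁ , e₂ , e₃) (f₁ , f₂ , f₃) =
  mod-trans {+ 8} {x₁} {t₁} e₁ f₁ , mod-trans {+ 2} {x₂} {t₂} e₂ f₂ , mod-trans {+ 8} {x₃} {t₃} e₃ f₃

∼-respected : ∀ M → (+ 4) Signed.∣ a12 M → (+ 4) Signed.∣ a32 M →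
              ∀ {x t} → x ∼ t → M · x ∼ M · t
∼-respected (mat m₁₁ _ m₁₃ m₂₁ m₂₂ m₂₃ m₃₁ _ m₃₃) (Signed.divides s refl) (Signed.divides s′ refl)
            {x₁ , x₂ , x₃} {t₁ , t₂ , t₃} (e₁ , e₂ , e₃)
  with mod-elim {+ 8} {x₁} {t₁} e₁ | mod-elim {+ 2} {x₂} {t₂} e₂ | mod-elim {+ 8} {x₃} {t₃} e₃
... | p , refl | q , refl | r , refl =
  mod-intro (m₁₁ * p + s * q + m₁₃ * r) (outer m₁₁ s m₁₃ t₁ t₂ t₃ p q r) ,
  mod-intro (m₂₁ * p * + 4 + m₂₂ * q + m₂₃ * r * + 4) (inner m₂₁ m₂₂ m₂₃ t₁ t₂ t₃ p q r) ,
  mod-intro (m₃₁ * p + s′ * q + m₃₃ * r) (outer m₃₁ s′ m₃₃ t₁ t₂ t₃ p q r)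
  where
  outer : ∀ a s c t₁ t₂ t₃ p q r →
    a * (t₁ + p * + 8) + s * + 4 * (t₂ + q * + 2) + c * (t₃ + r * + 8)
    ≡ (a * t₁ + s * + 4 * t₂ + c * t₃) + (a * p + s * q + c * r) * + 8
  outer = solve-∀
  inner : ∀ a b c t₁ t₂ t₃ p q r →
    a * (t₁ + p * + 8) + b * (t₂ + q * + 2) + c * (t₃ + r * + 8)
    ≡ (a * t₁ + b * t₂ + c * t₃) + (a * p * + 4 + b * q + c * r * + 4) * + 2
  inner = solve-∀

infix 4 _≡₈?_ _≡₂?_ _∼?_
_≡₈?_ : ∀ a b → Dec (a ≡₈ b)
a ≡₈? b = 8 ℕ∣.∣? ∣ a - b ∣

_≡₂?_ : ∀ a b → Dec (a ≡₂ b)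
a ≡₂? b = 2 ℕ∣.∣? ∣ a - b ∣

_∼?_ : ∀ x t → Dec (x ∼ t)
(x₁ , x₂ , x₃) ∼? (t₁ , t₂ , t₃) = x₁ ≡₈? t₁ ×-dec x₂ ≡₂? t₂ ×-dec x₃ ≡₈? t₃

-- Residue tables: the classes modulo 8ℤ ⊕ 2ℤ ⊕ 8ℤ met by each orbit.
table : Kind → List Vec3
table o₁ = (+ 1 , + 0 , + 1) ∷ (+ 1 , + 0 , + 3) ∷ (+ 3 , + 0 , + 1) ∷ (+ 3 , + 0 , + 3) ∷ []
table o₂ = (- + 1 , + 0 , - + 1) ∷ (- + 1 , + 0 , - + 3) ∷ (- + 3 , + 0 , - + 1) ∷ (- + 3 , + 0 , - + 3) ∷ []
table o₃ = (- + 1 , + 0 , + 1) ∷ (- + 1 , + 0 , + 3) ∷ (- + 3 , + 0 , + 1) ∷ (- + 3 , + 0 , + 3)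
         ∷ (+ 1 , + 0 , - + 1) ∷ (+ 1 , + 0 , - + 3) ∷ (+ 3 , + 0 , - + 1) ∷ (+ 3 , + 0 , - + 3) ∷ []
table o₄ = (+ 2 , + 1 , + 0) ∷ (+ 2 , + 1 , + 4) ∷ (+ 0 , + 1 , + 2) ∷ (+ 4 , + 1 , + 2) ∷ []
table o₅ = (- + 2 , + 1 , + 0) ∷ (- + 2 , + 1 , + 4) ∷ (+ 0 , + 1 , - + 2) ∷ (+ 4 , + 1 , - + 2) ∷ []

Residue : Kind → Vec3 → Set
Residue k x = Any (x ∼_) (table k)

residue? : ∀ k x → Dec (Residue k x)
residue? k x = Any.any? (x ∼?_) (table k)

ClosedAt : Kind → Vec3 → Set
ClosedAt k t = Residue k (B · t) × Residue k (B⁻¹ · t) × Residue k (J · t)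

tables-closed : ∀ k → All (ClosedAt k) (table k)
tables-closed = from-yes (Fin.all? λ k →
  All.all? (λ t → residue? k (B · t) ×-dec residue? k (B⁻¹ · t) ×-dec residue? k (J · t)) (table k))

reps-in-tables : ∀ k → Residue k (rep k)
reps-in-tables = from-yes (Fin.all? λ k → residue? k (rep k))

residue-stable : ∀ k → Stable (Residue k)
residue-stable k = record
  { under-B   = λ {v} → move B   (Signed.divides (+ 1) refl)   (Signed.divides (+ 0) refl) proj₁ v
  ; under-B⁻¹ = λ {v} → move B⁻¹ (Signed.divides (- + 1) refl) (Signed.divides (+ 0) refl) (proj₁ ∘ proj₂) v
  ; under-J   = λ {v} → move J   (Signed.divides (+ 0) refl)   (Signed.divides (+ 0) refl) (proj₂ ∘ proj₂) v
  }
  where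
  move : ∀ G → (+ 4) Signed.∣ a12 G → (+ 4) Signed.∣ a32 G →
         (∀ {t} → ClosedAt k t → Residue k (G · t)) → ∀ x → Residue k x → Residue k (G · x)
  move G 4∣a₁₂ 4∣a₃₂ closed x =
    All.lookupWith {R = λ _ → Residue k (G · x)}
      (λ {t} t-closed x∼t →
         Any.map (∼-trans {G · x} {G · t} (∼-respected G 4∣a₁₂ 4∣a₃₂ {x} {t} x∼t)) (closed {t} t-closed))
      (tables-closed k)

Odd⁺ Odd⁻ : ℤ → Set
Odd⁺ a = (a ≡₈ + 1) ⊎ (a ≡₈ + 3)
Odd⁻ a = (a ≡₈ - + 1) ⊎ (a ≡₈ - + 3)

Cond : Kind → Vec3 → Set
Cond o₁ (x₁ , _ , x₃) = Odd⁺ x₁ × Odd⁺ x₃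
Cond o₂ (x₁ , _ , x₃) = Odd⁻ x₁ × Odd⁻ x₃
Cond o₃ (x₁ , _ , x₃) = (Odd⁻ x₁ × Odd⁺ x₃) ⊎ (Odd⁻ x₃ × Odd⁺ x₁)
Cond o₄ (x₁ , _ , x₃) = (x₁ ≡₈ + 2) ⊎ (x₃ ≡₈ + 2)
Cond o₅ (x₁ , _ , x₃) = (x₁ ≡₈ - + 2) ⊎ (x₃ ≡₈ - + 2)

odd⁺? : ∀ a → Dec (Odd⁺ a)
odd⁺? a = a ≡₈? + 1 ⊎-dec a ≡₈? + 3

odd⁻? : ∀ a → Dec (Odd⁻ a)
odd⁻? a = a ≡₈? - + 1 ⊎-dec a ≡₈? - + 3

cond? : ∀ k x → Dec (Cond k x)
cond? o₁ (x₁ , _ , x₃) = odd⁺? x₁ ×-dec odd⁺? x₃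
cond? o₂ (x₁ , _ , x₃) = odd⁻? x₁ ×-dec odd⁻? x₃
cond? o₃ (x₁ , _ , x₃) = (odd⁻? x₁ ×-dec odd⁺? x₃) ⊎-dec (odd⁻? x₃ ×-dec odd⁺? x₁)
cond? o₄ (x₁ , _ , x₃) = x₁ ≡₈? + 2 ⊎-dec x₃ ≡₈? + 2
cond? o₅ (x₁ , _ , x₃) = x₁ ≡₈? - + 2 ⊎-dec x₃ ≡₈? - + 2

shift : ∀ x t r → x ≡₈ t → t ≡₈ r → x ≡₈ r
shift x t r = mod-trans {+ 8} {x} {t} {r}

odd⁺-shift : ∀ x t → x ≡₈ t → Odd⁺ t → Odd⁺ x
odd⁺-shift x t e = Sum.map (shift x t (+ 1) e) (shift x t (+ 3) e)

odd⁻-shift : ∀ x t → x ≡₈ t → Odd⁻ t → Odd⁻ x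
odd⁻-shift x t e = Sum.map (shift x t (- + 1) e) (shift x t (- + 3) e)

cond-resp : ∀ k x t → x ∼ t → Cond k t → Cond k x
cond-resp o₁ (x₁ , _ , x₃) (t₁ , _ , t₃) (e₁ , _ , e₃) =
  Product.map (odd⁺-shift x₁ t₁ e₁) (odd⁺-shift x₃ t₃ e₃)
cond-resp o₂ (x₁ , _ , x₃) (t₁ , _ , t₃) (e₁ , _ , e₃) =
  Product.map (odd⁻-shift x₁ t₁ e₁) (odd⁻-shift x₃ t₃ e₃)
cond-resp o₃ (x₁ , _ , x₃) (t₁ , _ , t₃) (e₁ , _ , e₃) =
  Sum.map (Product.map (odd⁻-shift x₁ t₁ e₁) (odd⁺-shift x₃ t₃ e₃))
          (Product.map (odd⁻-shift x₃ t₃ e₃) (odd⁺-shift x₁ t₁ e₁))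
cond-resp o₄ (x₁ , _ , x₃) (t₁ , _ , t₃) (e₁ , _ , e₃) =
  Sum.map (shift x₁ t₁ (+ 2) e₁) (shift x₃ t₃ (+ 2) e₃)
cond-resp o₅ (x₁ , _ , x₃) (t₁ , _ , t₃) (e₁ , _ , e₃) =
  Sum.map (shift x₁ t₁ (- + 2) e₁) (shift x₃ t₃ (- + 2) e₃)

tables-satisfy : ∀ k → All (Cond k) (table k)
tables-satisfy = from-yes (Fin.all? λ k → All.all? (cond? k) (table k))

tables-exclusive : ∀ j k → All (λ t → Cond k t → j ≡ k) (table j)
tables-exclusive = from-yes (Fin.all? λ j → Fin.all? λ k →
  All.all? (λ t → cond? k t →-dec j Fin.≟ k) (table j))

residue⇒cond : ∀ k x → Residue k x → Cond k x
residue⇒cond k x =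
  All.lookupWith {R = λ _ → Cond k x} (λ {t} cond-t x∼t → cond-resp k x t x∼t cond-t) (tables-satisfy k)

residue-determines-kind : ∀ j k x → Residue j x → Cond k x → j ≡ k
residue-determines-kind j k x r c =
  All.lookupWith {R = λ _ → j ≡ k}
    (λ {t} exclusive x∼t → exclusive (cond-resp k t x (∼-sym {x} {t} x∼t) c)) (tables-exclusive j k) r

-- The criterion for a single orbit.  Forward: the residue class of rep k is
-- carried along its orbit and implies Cond k.  Backward: by descent x lies in
-- some orbit j, and Cond k forces j = k.
orbit-criterion : ∀ k x → Q x ≡ + 2 → InOrbit (rep k) x ⇔ Cond k x
orbit-criterion k x q = mk⇔ forward backward
  where
  residue-of : ∀ {j} → InOrbit (rep j) x → Residue j x
  residue-of {j} o = constant-on-orbits (residue-stable j) o (reps-in-tables j)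

  forward : InOrbit (rep k) x → Cond k x
  forward o = residue⇒cond k x (residue-of o)

  backward : Cond k x → InOrbit (rep k) x
  backward c with descent x q
  ... | j , o = subst (λ i → InOrbit (rep i) x) (residue-determines-kind j k x (residue-of o) c) o

theorem8p1 : (x₁ x₂ x₃ : ℤ) → x₃ * x₃ - (+ 2) * (x₂ * x₂) + x₁ * x₁ ≡ + 2 →
      (InOrbit (+ 1 , + 0 , + 1) (x₁ , x₂ , x₃) ⇔
         (((x₁ ≡₈ + 1) ⊎ (x₁ ≡₈ + 3)) × ((x₃ ≡₈ + 1) ⊎ (x₃ ≡₈ + 3))))
    × (InOrbit (- + 1 , + 0 , - + 1) (x₁ , x₂ , x₃) ⇔
         (((x₁ ≡₈ - + 1) ⊎ (x₁ ≡₈ - + 3)) × ((x₃ ≡₈ - + 1) ⊎ (x₃ ≡₈ - + 3))))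
    × (InOrbit (- + 1 , + 0 , + 1) (x₁ , x₂ , x₃) ⇔
         ((((x₁ ≡₈ - + 1) ⊎ (x₁ ≡₈ - + 3)) × ((x₃ ≡₈ + 1) ⊎ (x₃ ≡₈ + 3)))
          ⊎ (((x₃ ≡₈ - + 1) ⊎ (x₃ ≡₈ - + 3)) × ((x₁ ≡₈ + 1) ⊎ (x₁ ≡₈ + 3)))))
    × (InOrbit (+ 2 , + 1 , + 0) (x₁ , x₂ , x₃) ⇔
         ((x₁ ≡₈ + 2) ⊎ (x₃ ≡₈ + 2)))
    × (InOrbit (- + 2 , + 1 , + 0) (x₁ , x₂ , x₃) ⇔
         ((x₁ ≡₈ - + 2) ⊎ (x₃ ≡₈ - + 2)))
theorem8p1 x₁ x₂ x₃ q =
  criterion o₁ , criterion o₂ , criterion o₃ , criterion o₄ , criterion o₅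
  where
  criterion : ∀ k → InOrbit (rep k) (x₁ , x₂ , x₃) ⇔ Cond k (x₁ , x₂ , x₃)
  criterion k = orbit-criterion k (x₁ , x₂ , x₃) q
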